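{- Let $\mathrm{L}=\mathcal R\cup\mathcal D$ be a set-sized relational $\omega$-signature, $\mathcal C$ an infinite set of constants disjoint from $\mathrm{L}$, and $S$ a set which is a consistency property all of whose elements are finite sets of $\mathrm{L}(\mathcal C)_{\infty\omega}$-sentences. Then for every $s\in S$, the sequent $s\vdash\emptyset$ is not derivable.
   Context: Relational $\omega$-signature: finitary relation symbols $\mathcal R$ and constants $\mathcal D$; $\mathrm{L}(\mathcal C)$ adds the constants of $\mathcal C$. $\mathrm{L}_{\infty\omega}$-formulae: closure of atomic formulae under $\neg$, set-sized $\bigwedge,\bigvee$ with finitely many free variables jointly, and finite quantification. $\phi\neg$: $\neg\phi$ for atomic $\phi$; $(\neg\chi)\neg=\chi$; $(\bigwedge\Phi)\neg=\bigvee\{\neg\chi:\chi\in\Phi\}$; $(\bigvee\Phi)\neg=\bigwedge\{\neg\chi:\chi\in\Phi\}$; $(\forall\bar v\chi)\neg=\exists\bar v\neg\chi$; $(\exists\bar v\chi)\neg=\forall\bar v\neg\chi$. Consistency property: a set $S$ of sets of sentences such that for each $s\in S$: (Con) no $r\in S$ contains both $\phi$ and $\neg\phi$; (Ind.1) $\neg\phi\in s\Rightarrow s\cup\{\phi\neg\}\in S$; (Ind.2) $\bigwedge\Phi\in s\Rightarrow s\cup\{\phi\}\in S$ for all $\phi\in\Phi$; (Ind.3) $\forall\bar v\phi(\bar v)\in s\Rightarrow s\cup\{\phi(\bar c)\}\in S$ for all $\bar c\in(\mathcal C\cup\mathcal D)^{|\bar v|}$; (Ind.4) $\bigvee\Phi\in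 s\Rightarrow s\cup\{\phi\}\in S$ for some $\phi\in\Phi$; (Ind.5) $\exists\bar v\phi(\bar v)\in s\Rightarrow s\cup\{\phi(\bar c)\}\in S$ for some $\bar c\in\mathcal C^{|\bar v|}$; (Str.1) $c=d\in s\Rightarrow s\cup\{d=c\}\in S$ ($c,d\in\mathcal C\cup\mathcal D$); (Str.2) $\{c=d,\phi(d)\}\subseteq s\Rightarrow s\cup\{\phi(c)\}\in S$; (Str.3) for each $d\in\mathcal C\cup\mathcal D$ some $c\in\mathcal C$ has $s\cup\{c=d\}\in S$. $\Gamma\vdash\Delta$ refers to the infinitary sequent calculus: formulae use $\neg,\bigwedge,\forall$; a derivation is an ordinal-indexed sequence of sequents ending in $\Gamma\vdash\Delta$, each an axiom or obtained from earlier ones by: Axiom $\Gamma,\phi\vdash\phi,\Delta$; Cut (from $\Gamma,\phi\vdash\Delta$ and $\Gamma'\vdash\phi,\Delta'$ infer $\Gamma,\Gamma'\vdash\Delta,\Delta'$); Substitution of variables; Weakening; Left/Right negation; Left conjunction (from $\Gamma,\Gamma'\vdash\Delta$ infer $\Gamma,\bigwedge\Gamma'\vdash\Delta$); Right conjunction (from $\Gamma\vdash\phi_i,\Delta$ for all $i\in I$ infer $\Gamma\vdash\bigwedge_i\phi_i,\Delta$); Left quantification (from $\Gamma,\phi(\bar t/\bar v)\vdash\Delta$ infer $\Gamma,\forall\bar v\phi\vdash\Delta$); Right quantification (from $\Gamma\vdash\phi(\bar w/\bar v),\Delta$ infer $\Gamma\vdash\forall\bar v\phi,\Delta$ if no variable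 of $\bar w$ is free in $\Gamma\cup\Delta\cup\{\phi\}$); Equality axioms $v_\alpha=v_\beta\vdash v_\beta=v_\alpha$ and $\bar u=\bar t,\phi(\bar t)\vdash\phi(\bar u)$. -}

module Defs where

open import Level using (Lift) renaming (zero to lzero; suc to lsuc)
open import Data.Nat using (ℕ; zero; suc; _+_)
open import Data.Fin using (Fin; splitAt; _↑ˡ_; _↑ʳ_)
open import Data.Vec using (Vec; []; _∷_; lookup; map)
open import Data.List using (List) renaming (_∷_ to _∷'_)
open import Data.List.Membership.Propositional using (_∈_)
open import Data.Sum using (_⊎_; inj₁; inj₂; [_,_]′)
open import Data.Product using (Σ; _×_)
open import Data.Empty using (⊥)
open import Relation.Nullary using (¬_)
open import Relation.Binary.PropositionalEquality using (_≡_)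
open import Function.Bundles using (_↔_)

Infinite : Set → Set
Infinite C = (n : ℕ) → ¬ (C ↔ Fin n)

-- A set-sized relational ω-signature: relation symbols R with finite arities
-- ar, constants D; C is the set of new constants (disjoint from L, since the
-- constants of L(C) are D ⊎ C).
module _ {R : Set} (ar : R → ℕ) (D C : Set) where

  K : Set
  K = D ⊎ C

  data Term (n : ℕ) : Set where
    var : Fin n → Term n
    con : K → Term n

  Sub : ℕ → ℕ → Set
  Sub m n = Fin m → Term n

  subT : ∀ {m n} → Sub m n → Term m → Term n
  subT σ (var i) = σ i
  subT σ (con c) = con c

  wkT : ∀ {n} k → Term n → Term (k + n)
  wkT k (var i) = var (k ↑ʳ i)
  wkT k (con c) = con c

  -- lift a substitution under a binder of k variables (bound vars come first)
  liftS : ∀ {m n} k → Sub m n → Sub (k + m) (k + n)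
  liftS {m} {n} k σ i = [ (λ j → var (j ↑ˡ n)) , (λ j → wkT k (σ j)) ]′ (splitAt k i)

  instS : ∀ {n k} → Vec (Term n) k → Sub (k + n) n
  instS {n} {k} ts i = [ lookup ts , var ]′ (splitAt k i)

  -- Conjunctions and
  -- disjunctions are over set-sized families, all of whose members live in
  -- the same finite scope (finitely many free variables jointly);
  -- quantification binds a finite tuple of k variables.
  data Formula (n : ℕ) : Set₁ where
    rel  : (r : R) → Vec (Term n) (ar r) → Formula n
    _≐_  : Term n → Term n → Formula n
    ¬'   : Formula n → Formula n
    ⋀ ⋁  : (I : Set) → (I → Formula n) → Formula n
    ∀' ∃' : (k : ℕ) → Formula (k + n) → Formula n

  subF : ∀ {m n} → Sub m n → Formula m → Formula n
  subF σ (rel r ts) = rel r (map (subT σ) ts)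
  subF σ (t ≐ u) = subT σ t ≐ subT σ u
  subF σ (¬' φ) = ¬' (subF σ φ)
  subF σ (⋀ I f) = ⋀ I (λ i → subF σ (f i))
  subF σ (⋁ I f) = ⋁ I (λ i → subF σ (f i))
  subF σ (∀' k φ) = ∀' k (subF (liftS k σ) φ)
  subF σ (∃' k φ) = ∃' k (subF (liftS k σ) φ)

  inst : ∀ {n k} → Vec (Term n) k → Formula (k + n) → Formula n
  inst ts φ = subF (instS ts) φ

  Sentence : Set₁
  Sentence = Formula 0

  neg : ∀ {n} → Formula n → Formula n
  neg (rel r ts) = ¬' (rel r ts)
  neg (t ≐ u) = ¬' (t ≐ u)
  neg (¬' χ) = χ
  neg (⋀ I f) = ⋁ I (λ i → ¬' (f i))
  neg (⋁ I f) = ⋀ I (λ i → ¬' (f i))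
  neg (∀' k χ) = ∃' k (¬' χ)
  neg (∃' k χ) = ∀' k (¬' χ)

  -- Consistency property.  A finite set of sentences is presented by a list;
  -- s ∪ {φ} is φ ∷ s.
  record IsConsistencyProperty (S : List Sentence → Set₁) : Set₁ where
    field
      Con  : ∀ r → S r → ∀ φ → φ ∈ r → ¬' φ ∈ r → ⊥
      Ind1 : ∀ s → S s → ∀ φ → ¬' φ ∈ s → S (neg φ ∷' s)
      Ind2 : ∀ s → S s → ∀ I (f : I → Sentence) → ⋀ I f ∈ s → ∀ i → S (f i ∷' s)
      Ind3 : ∀ s → S s → ∀ k (φ : Formula (k + 0)) → ∀' k φ ∈ s →
             (cs : Vec K k) → S (inst (map con cs) φ ∷' s)
      Ind4 : ∀ s → S s → ∀ I (f : I → Sentence) → ⋁ I f ∈ s →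
             Σ I (λ i → S (f i ∷' s))
      Ind5 : ∀ s → S s → ∀ k (φ : Formula (k + 0)) → ∃' k φ ∈ s →
             Σ (Vec C k) (λ cs → S (inst (map (λ c → con (inj₂ c)) cs) φ ∷' s))
      Str1 : ∀ s → S s → ∀ (c d : K) → (con c ≐ con d) ∈ s → S ((con d ≐ con c) ∷' s)
      Str2 : ∀ s → S s → ∀ (c d : K) (φ : Formula 1) →
             (con c ≐ con d) ∈ s → inst (con d ∷ []) φ ∈ s →
             S (inst (con c ∷ []) φ ∷' s)
      Str3 : ∀ s → S s → ∀ (d : K) → Σ C (λ c → S ((con (inj₂ c) ≐ con d) ∷' s))

  data BFormula (n : ℕ) : Set₁ where
    brel : (r : R) → Vec (Term n) (ar r) → BFormula n
    _≐ᵇ_ : Term n → Term n → BFormula n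
    b¬   : BFormula n → BFormula n
    b⋀   : (I : Set) → (I → BFormula n) → BFormula n
    b∀   : (k : ℕ) → BFormula (k + n) → BFormula n

  subB : ∀ {m n} → Sub m n → BFormula m → BFormula n
  subB σ (brel r ts) = brel r (map (subT σ) ts)
  subB σ (t ≐ᵇ u) = subT σ t ≐ᵇ subT σ u
  subB σ (b¬ φ) = b¬ (subB σ φ)
  subB σ (b⋀ I f) = b⋀ I (λ i → subB σ (f i))
  subB σ (b∀ k φ) = b∀ k (subB (liftS k σ) φ)

  instB : ∀ {n k} → Vec (Term n) k → BFormula (k + n) → BFormula n
  instB ts φ = subB (instS ts) φ

  -- ⋁ and ∃ as abbreviations: ⋁Φ = ¬⋀{¬φ}, ∃v̄φ = ¬∀v̄¬φ
  tr : ∀ {n} → Formula n → BFormula n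
  tr (rel r ts) = brel r ts
  tr (t ≐ u) = t ≐ᵇ u
  tr (¬' φ) = b¬ (tr φ)
  tr (⋀ I f) = b⋀ I (λ i → tr (f i))
  tr (⋁ I f) = b¬ (b⋀ I (λ i → b¬ (tr (f i))))
  tr (∀' k φ) = b∀ k (tr φ)
  tr (∃' k φ) = b¬ (b∀ k (b¬ (tr φ)))

  FSet : ℕ → Set₂
  FSet n = BFormula n → Set₁

  _∪_ : ∀ {n} → FSet n → FSet n → FSet n
  (Γ ∪ Δ) ψ = Γ ψ ⊎ Δ ψ

  ⟨_⟩ : ∀ {n} → BFormula n → FSet n
  ⟨ φ ⟩ ψ = ψ ≡ φ

  ∅ : ∀ {n} → FSet n
  ∅ _ = Lift (lsuc lzero) ⊥

  _⊆_ : ∀ {n} → FSet n → FSet n → Set₁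
  Γ ⊆ Δ = ∀ ψ → Γ ψ → Δ ψ

  _[_] : ∀ {m n} → FSet m → Sub m n → FSet n
  (Γ [ σ ]) ψ = Σ (BFormula _) (λ φ → Γ φ × subB σ φ ≡ ψ)

  range : ∀ {n} {I : Set} → (I → BFormula n) → FSet n
  range {I = I} f ψ = Σ I (λ i → f i ≡ ψ)

  wkS : ∀ {n} k → Sub n (k + n)
  wkS k i = var (k ↑ʳ i)

  data Derivable : (n : ℕ) → FSet n → FSet n → Set₂ where
    axiom  : ∀ {n} (Γ Δ : FSet n) φ → Derivable n (Γ ∪ ⟨ φ ⟩) (⟨ φ ⟩ ∪ Δ)
    cut    : ∀ {n} (Γ Γ' Δ Δ' : FSet n) φ →
             Derivable n (Γ ∪ ⟨ φ ⟩) Δ → Derivable n Γ' (⟨ φ ⟩ ∪ Δ') →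
             Derivable n (Γ ∪ Γ') (Δ ∪ Δ')
    subst  : ∀ {m n} (Γ Δ : FSet m) (σ : Sub m n) →
             Derivable m Γ Δ → Derivable n (Γ [ σ ]) (Δ [ σ ])
    weaken : ∀ {n} (Γ Γ' Δ Δ' : FSet n) → Γ ⊆ Γ' → Δ ⊆ Δ' →
             Derivable n Γ Δ → Derivable n Γ' Δ'
    negL   : ∀ {n} (Γ Δ : FSet n) φ →
             Derivable n Γ (⟨ φ ⟩ ∪ Δ) → Derivable n (Γ ∪ ⟨ b¬ φ ⟩) Δ
    negR   : ∀ {n} (Γ Δ : FSet n) φ →
             Derivable n (Γ ∪ ⟨ φ ⟩) Δ → Derivable n Γ (⟨ b¬ φ ⟩ ∪ Δ)
    conjL  : ∀ {n} (Γ Δ : FSet n) (I : Set) (f : I → BFormula n) →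
             Derivable n (Γ ∪ range f) Δ → Derivable n (Γ ∪ ⟨ b⋀ I f ⟩) Δ
    conjR  : ∀ {n} (Γ Δ : FSet n) (I : Set) (f : I → BFormula n) →
             (∀ i → Derivable n Γ (⟨ f i ⟩ ∪ Δ)) → Derivable n Γ (⟨ b⋀ I f ⟩ ∪ Δ)
    allL   : ∀ {n} (Γ Δ : FSet n) k (φ : BFormula (k + n)) (ts : Vec (Term n) k) →
             Derivable n (Γ ∪ ⟨ instB ts φ ⟩) Δ → Derivable n (Γ ∪ ⟨ b∀ k φ ⟩) Δ
    -- eigenvariables w̄ = the k fresh variables of the extended scope
    allR   : ∀ {n} (Γ Δ : FSet n) k (φ : BFormula (k + n)) →
             Derivable (k + n) (Γ [ wkS k ]) (⟨ φ ⟩ ∪ (Δ [ wkS k ])) →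
             Derivable n Γ (⟨ b∀ k φ ⟩ ∪ Δ)
    eqSym  : ∀ {n} (a b : Fin n) →
             Derivable n ⟨ var a ≐ᵇ var b ⟩ ⟨ var b ≐ᵇ var a ⟩
    eqSubst : ∀ {n k} (us ts : Vec (Term n) k) (φ : BFormula (k + n)) →
             Derivable n ((λ ψ → Σ (Fin k) (λ i → (lookup us i ≐ᵇ lookup ts i) ≡ ψ))
                            ∪ ⟨ instB ts φ ⟩)
                         ⟨ instB us φ ⟩

  SeqDerivable : List Sentence → Set₂
  SeqDerivable s = Derivable 0 (λ ψ → Σ Sentence (λ φ → φ ∈ s × tr φ ≡ ψ)) ∅

-- The members of S, ordered by extension, form a Beth-style forcing model in
-- which an atom is forced at p when every extension of p extends further to
-- one containing it, and ¬, ⋀, ∀ are read as in Kripke semantics, ∀ ranging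
-- over the constants of L(C).  Forcing is stable under double negation, so
-- every rule of the classical sequent calculus is sound for it; Str1 and Str2
-- make the equality axioms sound.  Conversely the closure conditions of a
-- consistency property make each p ∈ S force all of its members (Con refutes
-- a forced atom whose negation lies in p).  A derivation of s ⊢ ∅ would then
-- contradict the fact that s forces s.

module Submission where

open import Defs renaming (_∪_ to union; ⟨_⟩ to singleton; _[_] to image) hiding (_⊆_)
open import Data.Nat using (ℕ; suc; _+_)
open import Data.Fin using (Fin; zero; splitAt)
open import Data.Fin.Properties using (splitAt-↑ˡ; splitAt-↑ʳ)
open import Data.Vec using (Vec; []; _∷_; lookup; map)
open import Data.Vec.Properties using (map-∘; map-cong; map-id; lookup-map)
open import Data.Vec.Relation.Binary.Pointwise.Inductive as Pointwise using (Pointwise; []; _∷_)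
open import Data.List using (List; _∷_)
open import Data.List.Membership.Propositional using (_∈_; _∉_)
open import Data.List.Relation.Binary.Subset.Propositional using (_⊆_)
open import Data.List.Relation.Unary.Any using (here; there)
open import Data.Sum using (_⊎_; inj₁; inj₂; [_,_]′)
open import Data.Product using (Σ; _×_; _,_; proj₁; proj₂)
open import Function using (_∘_; id)
open import Function.Bundles using (_⇔_; mk⇔; Equivalence)
open import Data.Empty using (⊥)
open import Relation.Nullary using (¬_)
open import Relation.Binary.PropositionalEquality as ≡ using (_≡_; refl; sym; trans; cong; cong₂; _≗_)

module Forcing {R : Set} (ar : R → ℕ) (D C : Set)
  (S : List (Sentence ar D C) → Set₁) (cp : IsConsistencyProperty ar D C S) where

  open IsConsistencyProperty cp
  open Equivalence using (to; from)

  Tm : ℕ → Set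
  Tm = Term ar D C

  Fm : ℕ → Set₁
  Fm = Formula ar D C

  BF : ℕ → Set₁
  BF = BFormula ar D C

  Sn : Set₁
  Sn = Sentence ar D C

  Const : Set
  Const = K ar D C

  infix 4 _⊒_
  _⊒_ : List Sn → List Sn → Set₁
  q ⊒ p = S q × p ⊆ q

  ⊒-refl : ∀ {p} → S p → p ⊒ p
  ⊒-refl sp = sp , id

  ⊒-trans : ∀ {p q r} → r ⊒ q → q ⊒ p → r ⊒ p
  ⊒-trans (sr , q⊆r) (_ , p⊆q) = sr , q⊆r ∘ p⊆q

  ⊒-∷ : ∀ {p φ} → S (φ ∷ p) → φ ∷ p ⊒ p
  ⊒-∷ s = s , there

  Reachable : List Sn → Sn → Set₁
  Reachable p A = ¬ (∀ q → q ⊒ p → A ∉ q)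

  Inevitable : List Sn → Sn → Set₁
  Inevitable p A = ∀ q → q ⊒ p → Reachable q A

  reachable-bind : ∀ {p A B} → Reachable p A → (∀ q → q ⊒ p → A ∈ q → Reachable q B) → Reachable p B
  reachable-bind a f avoid = a (λ q q⊒p A∈q → f q q⊒p A∈q (λ r r⊒q → avoid r (⊒-trans r⊒q q⊒p)))

  reachable-∈ : ∀ {p A} → S p → A ∈ p → Reachable p A
  reachable-∈ sp A∈p avoid = avoid _ (⊒-refl sp) A∈p

  reachable-⊒ : ∀ {p q A} → q ⊒ p → Reachable q A → Reachable p A
  reachable-⊒ q⊒p a avoid = a (λ r r⊒q → avoid r (⊒-trans r⊒q q⊒p))

  reachable-∷ : ∀ {p A} → S (A ∷ p) → Reachable p A
  reachable-∷ s = reachable-⊒ (⊒-∷ s) (reachable-∈ s (here refl))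

  inevitable-mono : ∀ {p q A} → q ⊒ p → Inevitable p A → Inevitable q A
  inevitable-mono q⊒p h r r⊒q = h r (⊒-trans r⊒q q⊒p)

  inevitable-stable : ∀ {p A} → (∀ q → q ⊒ p → ¬ (∀ r → r ⊒ q → ¬ Inevitable r A)) → Inevitable p A
  inevitable-stable h q q⊒p avoid =
    h q q⊒p (λ r r⊒q A! → A! r (⊒-refl (proj₁ r⊒q)) (λ s s⊒r → avoid s (⊒-trans s⊒r r⊒q)))

  inevitable-∈ : ∀ {p A} → A ∈ p → Inevitable p A
  inevitable-∈ A∈p q q⊒p = reachable-∈ (proj₁ q⊒p) (proj₂ q⊒p A∈p)

  ¬∈⇒¬inevitable : ∀ {p A} → ¬' A ∈ p → ∀ q → q ⊒ p → ¬ Inevitable q A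
  ¬∈⇒¬inevitable ¬A∈p q q⊒p h =
    h q (⊒-refl (proj₁ q⊒p)) (λ r r⊒q A∈r → Con r (proj₁ r⊒q) _ A∈r (proj₂ r⊒q (proj₂ q⊒p ¬A∈p)))

  inevitable-≡ : ∀ {p A B} → A ≡ B → Inevitable p A ⇔ Inevitable p B
  inevitable-≡ refl = mk⇔ id id

  inevitable-≐-sym : ∀ {p} a b → Inevitable p (con a ≐ con b) → Inevitable p (con b ≐ con a)
  inevitable-≐-sym a b h q q⊒p =
    reachable-bind (h q q⊒p) (λ r r⊒q a≐b∈r → reachable-∷ (Str1 r (proj₁ r⊒q) a b a≐b∈r))

  -- Forcing

  Env : ℕ → Set
  Env n = Fin n → Const

  eval : ∀ {n} → Env n → Tm n → Const
  eval ρ (var i) = ρ i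
  eval ρ (con c) = c

  infixr 5 _++ᵉ_
  _++ᵉ_ : ∀ {n k} → Vec Const k → Env n → Env (k + n)
  _++ᵉ_ {k = k} cs ρ i = [ lookup cs , ρ ]′ (splitAt k i)

  ∅ᵉ : Env 0
  ∅ᵉ ()

  infix 4 _⊩[_]_
  _⊩[_]_ : ∀ {n} → List Sn → Env n → BF n → Set₁
  p ⊩[ ρ ] brel r ts = Inevitable p (rel r (map con (map (eval ρ) ts)))
  p ⊩[ ρ ] t ≐ᵇ u    = Inevitable p (con (eval ρ t) ≐ con (eval ρ u))
  p ⊩[ ρ ] b¬ φ      = ∀ q → q ⊒ p → ¬ (q ⊩[ ρ ] φ)
  p ⊩[ ρ ] b⋀ I f    = ∀ i → p ⊩[ ρ ] f i
  p ⊩[ ρ ] b∀ k φ    = ∀ cs → p ⊩[ cs ++ᵉ ρ ] φ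

  ⊩-mono : ∀ {n} (φ : BF n) {ρ p q} → q ⊒ p → p ⊩[ ρ ] φ → q ⊩[ ρ ] φ
  ⊩-mono (brel r ts) q⊒p h = inevitable-mono q⊒p h
  ⊩-mono (t ≐ᵇ u)    q⊒p h = inevitable-mono q⊒p h
  ⊩-mono (b¬ φ)      q⊒p h r r⊒q = h r (⊒-trans r⊒q q⊒p)
  ⊩-mono (b⋀ I f)    q⊒p h i = ⊩-mono (f i) q⊒p (h i)
  ⊩-mono (b∀ k φ)    q⊒p h cs = ⊩-mono φ q⊒p (h cs)

  ⊩-stable : ∀ {n} (φ : BF n) {ρ p} → p ⊩[ ρ ] b¬ (b¬ φ) → p ⊩[ ρ ] φ
  ⊩-stable (brel r ts) h = inevitable-stable h
  ⊩-stable (t ≐ᵇ u)    h = inevitable-stable h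
  ⊩-stable (b¬ φ)      h q q⊒p φ! = h q q⊒p (λ r r⊒q ¬φ! → ¬φ! r (⊒-refl (proj₁ r⊒q)) (⊩-mono φ r⊒q φ!))
  ⊩-stable (b⋀ I f)    h i = ⊩-stable (f i) (λ q q⊒p ¬fi → h q q⊒p (λ r r⊒q ⋀f → ¬fi r r⊒q (⋀f i)))
  ⊩-stable (b∀ k φ)    h cs = ⊩-stable φ (λ q q⊒p ¬φ → h q q⊒p (λ r r⊒q ∀φ → ¬φ r r⊒q (∀φ cs)))

  ⊩-dense : ∀ {n} (φ : BF n) {ρ p} → (∀ q → q ⊒ p → Σ (List Sn) λ r → r ⊒ q × r ⊩[ ρ ] φ) → p ⊩[ ρ ] φ
  ⊩-dense φ h = ⊩-stable φ λ q q⊒p ¬φ → let r , r⊒q , φ! = h q q⊒p in ¬φ r r⊒q φ!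

  -- Equality is a congruence for forcing

  Equated : List Sn → Const → Const → Set₁
  Equated p a b = a ≡ b ⊎ Inevitable p (con a ≐ con b)

  Equated-mono : ∀ {p q a b} → q ⊒ p → Equated p a b → Equated q a b
  Equated-mono q⊒p (inj₁ a≡b) = inj₁ a≡b
  Equated-mono q⊒p (inj₂ a≐b) = inj₂ (inevitable-mono q⊒p a≐b)

  Equated-sym : ∀ {p a b} → Equated p a b → Equated p b a
  Equated-sym (inj₁ a≡b) = inj₁ (sym a≡b)
  Equated-sym (inj₂ a≐b) = inj₂ (inevitable-≐-sym _ _ a≐b)

  record Template (N : ℕ) : Set₁ where
    field
      fill     : ∀ {n} → Vec (Tm n) N → Fm n
      fill-sub : ∀ {m n} (σ : Sub ar D C m n) ts → subF ar D C σ (fill ts) ≡ fill (map (subT ar D C σ) ts)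

  open Template

  plug : ∀ {N} → Template (suc N) → Const → Template N
  plug F c .fill ts = fill F (con c ∷ ts)
  plug F c .fill-sub σ ts = fill-sub F σ (con c ∷ ts)

  relTemplate : (r : R) → Template (ar r)
  relTemplate r .fill = rel r
  relTemplate r .fill-sub σ ts = refl

  ≐Template : Template 2
  ≐Template .fill (t ∷ u ∷ []) = t ≐ u
  ≐Template .fill-sub σ (t ∷ u ∷ []) = refl

  -- Rewrite one argument at a time with Str2, the open slot being variable 0.
  leibniz : ∀ {N} (F : Template N) {r xs ys} → S r → Pointwise (Equated r) xs ys →
            fill F (map con ys) ∈ r → Reachable r (fill F (map con xs))
  leibniz F sr [] F∈r = reachable-∈ sr F∈r
  leibniz F sr (inj₁ refl ∷ xs≈ys) F∈r = leibniz (plug F _) sr xs≈ys F∈r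
  leibniz F {r} {x ∷ xs} {y ∷ ys} sr (inj₂ x≐y ∷ xs≈ys) F∈r =
    reachable-bind (x≐y r (⊒-refl sr)) λ q q⊒r x≐y∈q →
      let sφx = Str2 q (proj₁ q⊒r) x y φ x≐y∈q (≡.subst (_∈ q) (sym (fill-φ y)) (proj₂ q⊒r F∈r))
      in reachable-⊒ (⊒-∷ sφx)
           (leibniz (plug F x) sφx (Pointwise.map (Equated-mono (⊒-trans (⊒-∷ sφx) q⊒r)) xs≈ys)
             (≡.subst (_∈ φ⟨ x ⟩ ∷ q) (fill-φ x) (here refl)))
    where
    φ : Fm 1
    φ = fill F (var zero ∷ map con ys)
    φ⟨_⟩ : Const → Sn
    φ⟨ c ⟩ = inst ar D C (con c ∷ []) φ
    fill-φ : ∀ c → φ⟨ c ⟩ ≡ fill F (con c ∷ map con ys)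
    fill-φ c = trans (fill-sub F _ (var zero ∷ map con ys)) (cong (fill F ∘ (con c ∷_)) (sym (map-∘ _ con ys)))

  inevitable-leibniz : ∀ {N} (F : Template N) {p xs ys} → Pointwise (Equated p) xs ys →
                       Inevitable p (fill F (map con ys)) → Inevitable p (fill F (map con xs))
  inevitable-leibniz F xs≈ys h q q⊒p =
    reachable-bind (h q q⊒p) λ r r⊒q F∈r →
      leibniz F (proj₁ r⊒q) (Pointwise.map (Equated-mono (⊒-trans r⊒q q⊒p)) xs≈ys) F∈r

  EquatedEnv : ∀ {n} → List Sn → Env n → Env n → Set₁
  EquatedEnv p ρ ρ′ = ∀ i → Equated p (ρ i) (ρ′ i)

  eval-Equated : ∀ {n p} {ρ ρ′ : Env n} → EquatedEnv p ρ ρ′ → ∀ t → Equated p (eval ρ t) (eval ρ′ t)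
  eval-Equated ρ≈ρ′ (var i) = ρ≈ρ′ i
  eval-Equated ρ≈ρ′ (con c) = inj₁ refl

  map-eval-Equated : ∀ {n N p} {ρ ρ′ : Env n} → EquatedEnv p ρ ρ′ → (ts : Vec (Tm n) N) →
                     Pointwise (Equated p) (map (eval ρ) ts) (map (eval ρ′) ts)
  map-eval-Equated ρ≈ρ′ []       = []
  map-eval-Equated ρ≈ρ′ (t ∷ ts) = eval-Equated ρ≈ρ′ t ∷ map-eval-Equated ρ≈ρ′ ts

  ++ᵉ-Equated : ∀ {n k p} (cs : Vec Const k) {ρ ρ′ : Env n} → EquatedEnv p ρ ρ′ →
                EquatedEnv p (cs ++ᵉ ρ) (cs ++ᵉ ρ′)
  ++ᵉ-Equated {k = k} cs ρ≈ρ′ i with splitAt k i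
  ... | inj₁ j = inj₁ refl
  ... | inj₂ j = ρ≈ρ′ j

  ⊩-resp-Equated : ∀ {n} (φ : BF n) {p} {ρ ρ′ : Env n} → EquatedEnv p ρ ρ′ → p ⊩[ ρ′ ] φ → p ⊩[ ρ ] φ
  ⊩-resp-Equated (brel r ts) ρ≈ρ′ = inevitable-leibniz (relTemplate r) (map-eval-Equated ρ≈ρ′ ts)
  ⊩-resp-Equated (t ≐ᵇ u)    ρ≈ρ′ =
    inevitable-leibniz ≐Template (eval-Equated ρ≈ρ′ t ∷ eval-Equated ρ≈ρ′ u ∷ [])
  ⊩-resp-Equated (b¬ φ)      ρ≈ρ′ h q q⊒p φ! =
    h q q⊒p (⊩-resp-Equated φ (λ i → Equated-sym (Equated-mono q⊒p (ρ≈ρ′ i))) φ!)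
  ⊩-resp-Equated (b⋀ I f)    ρ≈ρ′ h i = ⊩-resp-Equated (f i) ρ≈ρ′ (h i)
  ⊩-resp-Equated (b∀ k φ)    ρ≈ρ′ h cs = ⊩-resp-Equated φ (++ᵉ-Equated cs ρ≈ρ′) (h cs)

  ⊩-resp-≗ : ∀ {n} (φ : BF n) {p} {ρ ρ′ : Env n} → ρ ≗ ρ′ → p ⊩[ ρ ] φ → p ⊩[ ρ′ ] φ
  ⊩-resp-≗ φ ρ≗ρ′ = ⊩-resp-Equated φ (λ i → inj₁ (sym (ρ≗ρ′ i)))

  eval-subT : ∀ {m n} (ρ : Env n) (σ : Sub ar D C m n) t → eval ρ (subT ar D C σ t) ≡ eval (eval ρ ∘ σ) t
  eval-subT ρ σ (var i) = refl
  eval-subT ρ σ (con c) = refl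

  eval-wkT : ∀ {n k} (cs : Vec Const k) (ρ : Env n) t → eval (cs ++ᵉ ρ) (wkT ar D C k t) ≡ eval ρ t
  eval-wkT {n} {k} cs ρ (var i) = cong [ lookup cs , ρ ]′ (splitAt-↑ʳ k n i)
  eval-wkT cs ρ (con c) = refl

  eval-liftS : ∀ {m n k} (cs : Vec Const k) (ρ : Env n) (σ : Sub ar D C m n) →
               eval (cs ++ᵉ ρ) ∘ liftS ar D C k σ ≗ cs ++ᵉ (eval ρ ∘ σ)
  eval-liftS {k = k} cs ρ σ i with splitAt k i
  ... | inj₁ j = cong [ lookup cs , ρ ]′ (splitAt-↑ˡ k j _)
  ... | inj₂ j = eval-wkT cs ρ (σ j)

  eval-instS : ∀ {n k} (ρ : Env n) (ts : Vec (Tm n) k) → eval ρ ∘ instS ar D C ts ≗ map (eval ρ) ts ++ᵉ ρ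
  eval-instS {k = k} ρ ts i with splitAt k i
  ... | inj₁ j = sym (lookup-map j (eval ρ) ts)
  ... | inj₂ j = refl

  eval-wkS : ∀ {n k} (cs : Vec Const k) (ρ : Env n) → eval (cs ++ᵉ ρ) ∘ wkS ar D C k ≗ ρ
  eval-wkS {n} {k} cs ρ i = cong [ lookup cs , ρ ]′ (splitAt-↑ʳ k n i)

  map-eval-subT : ∀ {m n N} (ρ : Env n) (σ : Sub ar D C m n) (ts : Vec (Tm m) N) →
                  map (eval ρ) (map (subT ar D C σ) ts) ≡ map (eval (eval ρ ∘ σ)) ts
  map-eval-subT ρ σ ts = trans (sym (map-∘ _ _ ts)) (map-cong (eval-subT ρ σ) ts)

  ⊩-subB : ∀ {m n} (φ : BF m) (σ : Sub ar D C m n) (ρ : Env n) p →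
           p ⊩[ ρ ] subB ar D C σ φ ⇔ p ⊩[ eval ρ ∘ σ ] φ
  ⊩-subB (brel r ts) σ ρ p = inevitable-≡ (cong (rel r ∘ map con) (map-eval-subT ρ σ ts))
  ⊩-subB (t ≐ᵇ u)    σ ρ p = inevitable-≡ (cong₂ (λ a b → con a ≐ con b) (eval-subT ρ σ t) (eval-subT ρ σ u))
  ⊩-subB (b¬ φ)      σ ρ p = mk⇔ (λ h q q⊒p φ! → h q q⊒p (from (⊩-subB φ σ ρ q) φ!))
                                 (λ h q q⊒p φ! → h q q⊒p (to (⊩-subB φ σ ρ q) φ!))
  ⊩-subB (b⋀ I f)    σ ρ p = mk⇔ (λ h i → to (⊩-subB (f i) σ ρ p) (h i))
                                 (λ h i → from (⊩-subB (f i) σ ρ p) (h i))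
  ⊩-subB (b∀ k φ)    σ ρ p =
    mk⇔ (λ h cs → ⊩-resp-≗ φ (eval-liftS cs ρ σ) (to (⊩-subB φ (liftS ar D C k σ) (cs ++ᵉ ρ) p) (h cs)))
        (λ h cs → from (⊩-subB φ (liftS ar D C k σ) (cs ++ᵉ ρ) p) (⊩-resp-≗ φ (sym ∘ eval-liftS cs ρ σ) (h cs)))

  -- Soundness of the sequent calculus

  infixr 5 _∪_
  _∪_ : ∀ {n} → FSet ar D C n → FSet ar D C n → FSet ar D C n
  _∪_ = union ar D C

  ⟨_⟩ : ∀ {n} → BF n → FSet ar D C n
  ⟨_⟩ = singleton ar D C

  _[_] : ∀ {m n} → FSet ar D C m → Sub ar D C m n → FSet ar D C n
  _[_] = image ar D C

  All : ∀ {n} → (BF n → Set₁) → FSet ar D C n → Set₁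
  All P Γ = ∀ γ → Γ γ → P γ

  All-∪ : ∀ {n} {P : BF n → Set₁} {Γ Δ : FSet ar D C n} → All P Γ → All P Δ → All P (Γ ∪ Δ)
  All-∪ hΓ hΔ γ (inj₁ γ∈Γ) = hΓ γ γ∈Γ
  All-∪ hΓ hΔ γ (inj₂ γ∈Δ) = hΔ γ γ∈Δ

  All-∪ˡ : ∀ {n} {P : BF n → Set₁} {Γ Δ : FSet ar D C n} → All P (Γ ∪ Δ) → All P Γ
  All-∪ˡ h γ = h γ ∘ inj₁

  All-∪ʳ : ∀ {n} {P : BF n → Set₁} {Γ Δ : FSet ar D C n} → All P (Γ ∪ Δ) → All P Δ
  All-∪ʳ h γ = h γ ∘ inj₂

  All-⟨⟩ : ∀ {n} {P : BF n → Set₁} {φ : BF n} → P φ → All P ⟨ φ ⟩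
  All-⟨⟩ h γ refl = h

  infix 4 _⊩[_]*_ _⊩[_]¬*_
  _⊩[_]*_ : ∀ {n} → List Sn → Env n → FSet ar D C n → Set₁
  p ⊩[ ρ ]* Γ = All (p ⊩[ ρ ]_) Γ

  _⊩[_]¬*_ : ∀ {n} → List Sn → Env n → FSet ar D C n → Set₁
  p ⊩[ ρ ]¬* Δ = All (λ δ → p ⊩[ ρ ] b¬ δ) Δ

  ⊩*-mono : ∀ {n p q Γ} {ρ : Env n} → q ⊒ p → p ⊩[ ρ ]* Γ → q ⊩[ ρ ]* Γ
  ⊩*-mono q⊒p h γ = ⊩-mono γ q⊒p ∘ h γ

  ⊩¬*-mono : ∀ {n p q Δ} {ρ : Env n} → q ⊒ p → p ⊩[ ρ ]¬* Δ → q ⊩[ ρ ]¬* Δ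
  ⊩¬*-mono q⊒p h δ = ⊩-mono (b¬ δ) q⊒p ∘ h δ

  ⊩*-sub⁻ : ∀ {m n p Γ} {ρ : Env n} (σ : Sub ar D C m n) → p ⊩[ ρ ]* Γ [ σ ] → p ⊩[ eval ρ ∘ σ ]* Γ
  ⊩*-sub⁻ {p = p} {ρ = ρ} σ h γ γ∈Γ = to (⊩-subB γ σ ρ p) (h _ (γ , γ∈Γ , refl))

  ⊩¬*-sub⁻ : ∀ {m n p Δ} {ρ : Env n} (σ : Sub ar D C m n) → p ⊩[ ρ ]¬* Δ [ σ ] → p ⊩[ eval ρ ∘ σ ]¬* Δ
  ⊩¬*-sub⁻ {p = p} {ρ = ρ} σ h δ δ∈Δ = to (⊩-subB (b¬ δ) σ ρ p) (h _ (δ , δ∈Δ , refl))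

  ⊩*-wkS : ∀ {n k p Γ} {ρ : Env n} (cs : Vec Const k) → p ⊩[ ρ ]* Γ → p ⊩[ cs ++ᵉ ρ ]* Γ [ wkS ar D C k ]
  ⊩*-wkS {k = k} {p} {ρ = ρ} cs h _ (γ , γ∈Γ , refl) =
    from (⊩-subB γ (wkS ar D C k) (cs ++ᵉ ρ) p) (⊩-resp-≗ γ (sym ∘ eval-wkS cs ρ) (h γ γ∈Γ))

  ⊩¬*-wkS : ∀ {n k p Δ} {ρ : Env n} (cs : Vec Const k) → p ⊩[ ρ ]¬* Δ → p ⊩[ cs ++ᵉ ρ ]¬* Δ [ wkS ar D C k ]
  ⊩¬*-wkS {k = k} {p} {ρ = ρ} cs h _ (δ , δ∈Δ , refl) =
    from (⊩-subB (b¬ δ) (wkS ar D C k) (cs ++ᵉ ρ) p) (⊩-resp-≗ (b¬ δ) (sym ∘ eval-wkS cs ρ) (h δ δ∈Δ))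

  Valid : ∀ n → FSet ar D C n → FSet ar D C n → Set₁
  Valid n Γ Δ = ∀ (ρ : Env n) p → S p → p ⊩[ ρ ]* Γ → p ⊩[ ρ ]¬* Δ → ⊥

  ⊩¬-intro : ∀ {n Γ Δ φ p} {ρ : Env n} → Valid n (Γ ∪ ⟨ φ ⟩) Δ → p ⊩[ ρ ]* Γ → p ⊩[ ρ ]¬* Δ → p ⊩[ ρ ] b¬ φ
  ⊩¬-intro valid hΓ hΔ q q⊒p φ! =
    valid _ q (proj₁ q⊒p) (All-∪ (⊩*-mono q⊒p hΓ) (All-⟨⟩ φ!)) (⊩¬*-mono q⊒p hΔ)

  ⊩-intro : ∀ {n Γ Δ} φ {p} {ρ : Env n} → Valid n Γ (⟨ φ ⟩ ∪ Δ) → p ⊩[ ρ ]* Γ → p ⊩[ ρ ]¬* Δ → p ⊩[ ρ ] φ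
  ⊩-intro φ valid hΓ hΔ = ⊩-stable φ λ q q⊒p ¬φ →
    valid _ q (proj₁ q⊒p) (⊩*-mono q⊒p hΓ) (All-∪ (All-⟨⟩ ¬φ) (⊩¬*-mono q⊒p hΔ))

  sound : ∀ {n Γ Δ} → Derivable ar D C n Γ Δ → Valid n Γ Δ
  sound (axiom Γ Δ φ) ρ p sp hΓ hΔ = hΔ φ (inj₁ refl) p (⊒-refl sp) (hΓ φ (inj₂ refl))
  sound (cut Γ Γ′ Δ Δ′ φ d₁ d₂) ρ p sp hΓ hΔ =
    sound d₂ ρ p sp (All-∪ʳ hΓ) (All-∪ (All-⟨⟩ (⊩¬-intro (sound d₁) (All-∪ˡ hΓ) (All-∪ˡ hΔ))) (All-∪ʳ hΔ))
  sound (subst Γ Δ σ d) ρ p sp hΓ hΔ = sound d (eval ρ ∘ σ) p sp (⊩*-sub⁻ σ hΓ) (⊩¬*-sub⁻ σ hΔ)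
  sound (weaken Γ Γ′ Δ Δ′ Γ⊆Γ′ Δ⊆Δ′ d) ρ p sp hΓ hΔ =
    sound d ρ p sp (λ γ → hΓ γ ∘ Γ⊆Γ′ γ) (λ δ → hΔ δ ∘ Δ⊆Δ′ δ)
  sound (negL Γ Δ φ d) ρ p sp hΓ hΔ =
    sound d ρ p sp (All-∪ˡ hΓ) (All-∪ (All-⟨⟩ (hΓ (b¬ φ) (inj₂ refl))) hΔ)
  sound (negR Γ Δ φ d) ρ p sp hΓ hΔ =
    hΔ (b¬ φ) (inj₁ refl) p (⊒-refl sp) (⊩¬-intro (sound d) hΓ (All-∪ʳ hΔ))
  sound (conjL Γ Δ I f d) ρ p sp hΓ hΔ =
    sound d ρ p sp (All-∪ (All-∪ˡ hΓ) λ { _ (i , refl) → hΓ (b⋀ I f) (inj₂ refl) i }) hΔ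
  sound (conjR Γ Δ I f ds) ρ p sp hΓ hΔ =
    hΔ (b⋀ I f) (inj₁ refl) p (⊒-refl sp) (λ i → ⊩-intro (f i) (sound (ds i)) hΓ (All-∪ʳ hΔ))
  sound (allL Γ Δ k φ ts d) ρ p sp hΓ hΔ =
    sound d ρ p sp (All-∪ (All-∪ˡ hΓ) (All-⟨⟩ instance!)) hΔ
    where
    instance! : p ⊩[ ρ ] instB ar D C ts φ
    instance! = from (⊩-subB φ (instS ar D C ts) ρ p)
      (⊩-resp-≗ φ (sym ∘ eval-instS ρ ts) (hΓ (b∀ k φ) (inj₂ refl) (map (eval ρ) ts)))
  sound (allR Γ Δ k φ d) ρ p sp hΓ hΔ =
    hΔ (b∀ k φ) (inj₁ refl) p (⊒-refl sp)
      (λ cs → ⊩-intro φ (sound d) (⊩*-wkS cs hΓ) (⊩¬*-wkS cs (All-∪ʳ hΔ)))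
  sound (eqSym a b) ρ p sp hΓ hΔ = hΔ _ refl p (⊒-refl sp) (inevitable-≐-sym (ρ a) (ρ b) (hΓ _ refl))
  sound (eqSubst {k = k} us ts φ) ρ p sp hΓ hΔ =
    hΔ _ refl p (⊒-refl sp)
      (from (⊩-subB φ (instS ar D C us) ρ p)
        (⊩-resp-Equated φ us≈ts (to (⊩-subB φ (instS ar D C ts) ρ p) (hΓ _ (inj₂ refl)))))
    where
    us≈ts : EquatedEnv p (eval ρ ∘ instS ar D C us) (eval ρ ∘ instS ar D C ts)
    us≈ts i with splitAt k i
    ... | inj₁ j = inj₂ (hΓ _ (inj₁ (j , refl)))
    ... | inj₂ j = inj₁ refl

  -- The truth lemma

  -- Instances met below binders are kept as a list of substitutions rather
  -- than composed, which for infinitary ⋀ and ⋁ would need function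
  -- extensionality.
  infixr 5 _◅_
  data Subs : ℕ → ℕ → Set where
    ε   : ∀ {n} → Subs n n
    _◅_ : ∀ {m l n} → Sub ar D C m l → Subs l n → Subs m n

  subsF : ∀ {m n} → Subs m n → Fm m → Fm n
  subsF ε        φ = φ
  subsF (σ ◅ σs) φ = subsF σs (subF ar D C σ φ)

  subsT : ∀ {m n} → Subs m n → Tm m → Tm n
  subsT ε        t = t
  subsT (σ ◅ σs) t = subsT σs (subT ar D C σ t)

  liftSubs : ∀ {m n} k → Subs m n → Subs (k + m) (k + n)
  liftSubs k ε        = ε
  liftSubs k (σ ◅ σs) = liftS ar D C k σ ◅ liftSubs k σs

  infixl 5 _▻_
  _▻_ : ∀ {m l n} → Subs m l → Sub ar D C l n → Subs m n
  ε        ▻ σ = σ ◅ ε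
  (τ ◅ σs) ▻ σ = τ ◅ (σs ▻ σ)

  subsF-▻ : ∀ {m l n} (σs : Subs m l) (σ : Sub ar D C l n) φ → subsF (σs ▻ σ) φ ≡ subF ar D C σ (subsF σs φ)
  subsF-▻ ε        σ φ = refl
  subsF-▻ (τ ◅ σs) σ φ = subsF-▻ σs σ (subF ar D C τ φ)

  subsT-▻ : ∀ {m l n} (σs : Subs m l) (σ : Sub ar D C l n) t → subsT (σs ▻ σ) t ≡ subT ar D C σ (subsT σs t)
  subsT-▻ ε        σ t = refl
  subsT-▻ (τ ◅ σs) σ t = subsT-▻ σs σ (subT ar D C τ t)

  subsT-con : ∀ {m n} (σs : Subs m n) c → subsT σs (con c) ≡ con c
  subsT-con ε        c = refl
  subsT-con (σ ◅ σs) c = subsT-con σs c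

  subsF-rel : ∀ {m n} (σs : Subs m n) r ts → subsF σs (rel r ts) ≡ rel r (map (subsT σs) ts)
  subsF-rel ε        r ts = cong (rel r) (sym (map-id ts))
  subsF-rel (σ ◅ σs) r ts = trans (subsF-rel σs r (map (subT ar D C σ) ts)) (cong (rel r) (sym (map-∘ _ _ ts)))

  subsF-≐ : ∀ {m n} (σs : Subs m n) t u → subsF σs (t ≐ u) ≡ (subsT σs t ≐ subsT σs u)
  subsF-≐ ε        t u = refl
  subsF-≐ (σ ◅ σs) t u = subsF-≐ σs (subT ar D C σ t) (subT ar D C σ u)

  subsF-¬ : ∀ {m n} (σs : Subs m n) φ → subsF σs (¬' φ) ≡ ¬' (subsF σs φ)
  subsF-¬ ε        φ = refl
  subsF-¬ (σ ◅ σs) φ = subsF-¬ σs (subF ar D C σ φ)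

  subsF-⋀ : ∀ {m n} (σs : Subs m n) I f → subsF σs (⋀ I f) ≡ ⋀ I (subsF σs ∘ f)
  subsF-⋀ ε        I f = refl
  subsF-⋀ (σ ◅ σs) I f = subsF-⋀ σs I (subF ar D C σ ∘ f)

  subsF-⋁ : ∀ {m n} (σs : Subs m n) I f → subsF σs (⋁ I f) ≡ ⋁ I (subsF σs ∘ f)
  subsF-⋁ ε        I f = refl
  subsF-⋁ (σ ◅ σs) I f = subsF-⋁ σs I (subF ar D C σ ∘ f)

  subsF-∀ : ∀ {m n} (σs : Subs m n) k φ → subsF σs (∀' k φ) ≡ ∀' k (subsF (liftSubs k σs) φ)
  subsF-∀ ε        k φ = refl
  subsF-∀ (σ ◅ σs) k φ = subsF-∀ σs k (subF ar D C (liftS ar D C k σ) φ)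

  subsF-∃ : ∀ {m n} (σs : Subs m n) k φ → subsF σs (∃' k φ) ≡ ∃' k (subsF (liftSubs k σs) φ)
  subsF-∃ ε        k φ = refl
  subsF-∃ (σ ◅ σs) k φ = subsF-∃ σs k (subF ar D C (liftS ar D C k σ) φ)

  evalSubs : ∀ {m n} → Env n → Subs m n → Env m
  evalSubs ρ σs i = eval ρ (subsT σs (var i))

  eval-cong : ∀ {n} {ρ ρ′ : Env n} → ρ ≗ ρ′ → ∀ t → eval ρ t ≡ eval ρ′ t
  eval-cong ρ≗ρ′ (var i) = ρ≗ρ′ i
  eval-cong ρ≗ρ′ (con c) = refl

  ++ᵉ-cong : ∀ {n k} (cs : Vec Const k) {ρ ρ′ : Env n} → ρ ≗ ρ′ → cs ++ᵉ ρ ≗ cs ++ᵉ ρ′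
  ++ᵉ-cong {k = k} cs ρ≗ρ′ i with splitAt k i
  ... | inj₁ j = refl
  ... | inj₂ j = ρ≗ρ′ j

  eval-subsT : ∀ {m n} (ρ : Env n) (σs : Subs m n) t → eval ρ (subsT σs t) ≡ eval (evalSubs ρ σs) t
  eval-subsT ρ σs (var i) = refl
  eval-subsT ρ σs (con c) = cong (eval ρ) (subsT-con σs c)

  evalSubs-liftSubs : ∀ {m n k} (cs : Vec Const k) (ρ : Env n) (σs : Subs m n) →
                      evalSubs (cs ++ᵉ ρ) (liftSubs k σs) ≗ cs ++ᵉ evalSubs ρ σs
  evalSubs-liftSubs cs ρ ε i = refl
  evalSubs-liftSubs {k = k} cs ρ (σ ◅ σs) i = begin
    eval (cs ++ᵉ ρ) (subsT (liftSubs k σs) (liftS ar D C k σ i))  ≡⟨ eval-subsT (cs ++ᵉ ρ) (liftSubs k σs) (liftS ar D C k σ i) ⟩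
    eval (evalSubs (cs ++ᵉ ρ) (liftSubs k σs)) (liftS ar D C k σ i) ≡⟨ eval-cong (evalSubs-liftSubs cs ρ σs) (liftS ar D C k σ i) ⟩
    eval (cs ++ᵉ evalSubs ρ σs) (liftS ar D C k σ i)               ≡⟨ eval-liftS cs (evalSubs ρ σs) σ i ⟩
    (cs ++ᵉ eval (evalSubs ρ σs) ∘ σ) i                            ≡⟨ ++ᵉ-cong cs (sym ∘ eval-subsT ρ σs ∘ σ) i ⟩
    (cs ++ᵉ evalSubs ρ (σ ◅ σs)) i                                 ∎
    where open ≡.≡-Reasoning

  evalSubs-▻ : ∀ {m l n} (ρ : Env n) (σs : Subs m l) (σ : Sub ar D C l n) →
               evalSubs ρ (σs ▻ σ) ≗ evalSubs (eval ρ ∘ σ) σs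
  evalSubs-▻ ρ σs σ i = trans (cong (eval ρ) (subsT-▻ σs σ (var i))) (eval-subT ρ σ (subsT σs (var i)))

  closingEnv : ∀ {m} → Subs m 0 → Env m
  closingEnv = evalSubs ∅ᵉ

  subsT-closed : ∀ {m} (σs : Subs m 0) t → subsT σs t ≡ con (eval (closingEnv σs) t)
  subsT-closed σs t = trans (closed (subsT σs t)) (cong con (eval-subsT ∅ᵉ σs t))
    where
    closed : (t : Tm 0) → t ≡ con (eval ∅ᵉ t)
    closed (con c) = refl

  closingEnv-extend : ∀ {m k} (σs : Subs m 0) (ts : Vec (Tm 0) k) →
                      closingEnv (liftSubs k σs ▻ instS ar D C ts) ≗ map (eval ∅ᵉ) ts ++ᵉ closingEnv σs
  closingEnv-extend {k = k} σs ts i = begin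
    closingEnv (liftSubs k σs ▻ instS ar D C ts) i                   ≡⟨ evalSubs-▻ ∅ᵉ (liftSubs k σs) _ i ⟩
    evalSubs (eval ∅ᵉ ∘ instS ar D C ts) (liftSubs k σs) i           ≡⟨ eval-cong (eval-instS ∅ᵉ ts) (subsT (liftSubs k σs) (var i)) ⟩
    evalSubs (map (eval ∅ᵉ) ts ++ᵉ ∅ᵉ) (liftSubs k σs) i             ≡⟨ evalSubs-liftSubs (map (eval ∅ᵉ) ts) ∅ᵉ σs i ⟩
    (map (eval ∅ᵉ) ts ++ᵉ closingEnv σs) i                           ∎
    where open ≡.≡-Reasoning

  closingEnv-con : ∀ {m k} (σs : Subs m 0) (cs : Vec Const k) →
                   closingEnv (liftSubs k σs ▻ instS ar D C (map con cs)) ≗ cs ++ᵉ closingEnv σs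
  closingEnv-con σs cs i =
    trans (closingEnv-extend σs (map con cs) i)
          (cong (λ v → (v ++ᵉ closingEnv σs) i) (trans (sym (map-∘ _ _ cs)) (map-id cs)))

  closingEnv-new : ∀ {m k} (σs : Subs m 0) (cs : Vec C k) →
                   closingEnv (liftSubs k σs ▻ instS ar D C (map (con ∘ inj₂) cs)) ≗ map inj₂ cs ++ᵉ closingEnv σs
  closingEnv-new σs cs i =
    trans (closingEnv-extend σs (map (con ∘ inj₂) cs) i)
          (cong (λ v → (v ++ᵉ closingEnv σs) i) (sym (map-∘ _ _ cs)))

  subsF-rel-closed : ∀ {m} (σs : Subs m 0) r ts →
                     subsF σs (rel r ts) ≡ rel r (map con (map (eval (closingEnv σs)) ts))
  subsF-rel-closed σs r ts =
    trans (subsF-rel σs r ts) (cong (rel r) (trans (map-cong (subsT-closed σs) ts) (map-∘ con _ ts)))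

  subsF-≐-closed : ∀ {m} (σs : Subs m 0) t u →
                   subsF σs (t ≐ u) ≡ (con (eval (closingEnv σs) t) ≐ con (eval (closingEnv σs) u))
  subsF-≐-closed σs t u = trans (subsF-≐ σs t u) (cong₂ _≐_ (subsT-closed σs t) (subsT-closed σs u))

  ∈⇒⊩ : ∀ {m} (φ : Fm m) (σs : Subs m 0) {p} → S p → subsF σs φ ∈ p → p ⊩[ closingEnv σs ] tr ar D C φ
  ¬∈⇒⊩¬ : ∀ {m} (φ : Fm m) (σs : Subs m 0) {p} → S p → ¬' (subsF σs φ) ∈ p →
          p ⊩[ closingEnv σs ] b¬ (tr ar D C φ)

  ∈⇒⊩ (rel r ts) σs {p} sp φ∈p = inevitable-∈ (≡.subst (_∈ p) (subsF-rel-closed σs r ts) φ∈p)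
  ∈⇒⊩ (t ≐ u)    σs {p} sp φ∈p = inevitable-∈ (≡.subst (_∈ p) (subsF-≐-closed σs t u) φ∈p)
  ∈⇒⊩ (¬' φ)     σs {p} sp φ∈p = ¬∈⇒⊩¬ φ σs sp (≡.subst (_∈ p) (subsF-¬ σs φ) φ∈p)
  ∈⇒⊩ (⋀ I f)    σs {p} sp φ∈p i = ⊩-dense (tr ar D C (f i)) λ q q⊒p →
    let s = Ind2 q (proj₁ q⊒p) I _ (proj₂ q⊒p (≡.subst (_∈ p) (subsF-⋀ σs I f) φ∈p)) i
    in _ , ⊒-∷ s , ∈⇒⊩ (f i) σs s (here refl)
  ∈⇒⊩ (⋁ I f)    σs {p} sp φ∈p q q⊒p ⋀¬f =
    let i , s = Ind4 q (proj₁ q⊒p) I _ (proj₂ q⊒p (≡.subst (_∈ p) (subsF-⋁ σs I f) φ∈p))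
    in ⋀¬f i _ (⊒-∷ s) (∈⇒⊩ (f i) σs s (here refl))
  ∈⇒⊩ (∀' k φ)   σs {p} sp φ∈p cs = ⊩-dense (tr ar D C φ) λ q q⊒p →
    let s = Ind3 q (proj₁ q⊒p) k _ (proj₂ q⊒p (≡.subst (_∈ p) (subsF-∀ σs k φ) φ∈p)) cs
    in _ , ⊒-∷ s , ⊩-resp-≗ (tr ar D C φ) (closingEnv-con σs cs)
                     (∈⇒⊩ φ (liftSubs k σs ▻ _) s (here (subsF-▻ (liftSubs k σs) _ φ)))
  ∈⇒⊩ (∃' k φ)   σs {p} sp φ∈p q q⊒p ∀¬φ =
    let cs , s = Ind5 q (proj₁ q⊒p) k _ (proj₂ q⊒p (≡.subst (_∈ p) (subsF-∃ σs k φ) φ∈p))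
    in ∀¬φ (map inj₂ cs) _ (⊒-∷ s) (⊩-resp-≗ (tr ar D C φ) (closingEnv-new σs cs)
                                      (∈⇒⊩ φ (liftSubs k σs ▻ _) s (here (subsF-▻ (liftSubs k σs) _ φ))))

  ¬∈⇒⊩¬ (rel r ts) σs {p} sp ¬φ∈p = ¬∈⇒¬inevitable (≡.subst (_∈ p) (cong ¬' (subsF-rel-closed σs r ts)) ¬φ∈p)
  ¬∈⇒⊩¬ (t ≐ u)    σs {p} sp ¬φ∈p = ¬∈⇒¬inevitable (≡.subst (_∈ p) (cong ¬' (subsF-≐-closed σs t u)) ¬φ∈p)
  ¬∈⇒⊩¬ (¬' φ)     σs {p} sp ¬φ∈p q q⊒p ¬φ! =
    let s = Ind1 q (proj₁ q⊒p) _ (proj₂ q⊒p (≡.subst (_∈ p) (cong ¬' (subsF-¬ σs φ)) ¬φ∈p))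
    in ¬φ! _ (⊒-∷ s) (∈⇒⊩ φ σs s (here refl))
  ¬∈⇒⊩¬ (⋀ I f)    σs {p} sp ¬φ∈p q q⊒p ⋀f =
    let s₁ = Ind1 q (proj₁ q⊒p) _ (proj₂ q⊒p (≡.subst (_∈ p) (cong ¬' (subsF-⋀ σs I f)) ¬φ∈p))
        i , s₂ = Ind4 _ s₁ I _ (here refl)
    in ¬∈⇒⊩¬ (f i) σs s₂ (here refl) _ (⊒-refl s₂) (⊩-mono (tr ar D C (f i)) (⊒-trans (⊒-∷ s₂) (⊒-∷ s₁)) (⋀f i))
  ¬∈⇒⊩¬ (⋁ I f)    σs {p} sp ¬φ∈p q q⊒p ¬⋀¬f =
    let s₁ = Ind1 q (proj₁ q⊒p) _ (proj₂ q⊒p (≡.subst (_∈ p) (cong ¬' (subsF-⋁ σs I f)) ¬φ∈p))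
    in ¬⋀¬f _ (⊒-∷ s₁) λ i → ⊩-dense (b¬ (tr ar D C (f i))) λ r r⊒ →
         let s₂ = Ind2 r (proj₁ r⊒) I _ (proj₂ r⊒ (here refl)) i
         in _ , ⊒-∷ s₂ , ¬∈⇒⊩¬ (f i) σs s₂ (here refl)
  ¬∈⇒⊩¬ (∀' k φ)   σs {p} sp ¬φ∈p q q⊒p ∀φ =
    let s₁ = Ind1 q (proj₁ q⊒p) _ (proj₂ q⊒p (≡.subst (_∈ p) (cong ¬' (subsF-∀ σs k φ)) ¬φ∈p))
        cs , s₂ = Ind5 _ s₁ k _ (here refl)
    in ¬∈⇒⊩¬ φ (liftSubs k σs ▻ _) s₂ (here (cong ¬' (subsF-▻ (liftSubs k σs) _ φ))) _ (⊒-refl s₂)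
         (⊩-resp-≗ (tr ar D C φ) (sym ∘ closingEnv-new σs cs)
           (⊩-mono (tr ar D C φ) (⊒-trans (⊒-∷ s₂) (⊒-∷ s₁)) (∀φ (map inj₂ cs))))
  ¬∈⇒⊩¬ (∃' k φ)   σs {p} sp ¬φ∈p q q⊒p ¬∀¬φ =
    let s₁ = Ind1 q (proj₁ q⊒p) _ (proj₂ q⊒p (≡.subst (_∈ p) (cong ¬' (subsF-∃ σs k φ)) ¬φ∈p))
    in ¬∀¬φ _ (⊒-∷ s₁) λ cs → ⊩-dense (b¬ (tr ar D C φ)) λ r r⊒ →
         let s₂ = Ind3 r (proj₁ r⊒) k _ (proj₂ r⊒ (here refl)) cs
         in _ , ⊒-∷ s₂ , ⊩-resp-≗ (b¬ (tr ar D C φ)) (closingEnv-con σs cs)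
                           (¬∈⇒⊩¬ φ (liftSubs k σs ▻ _) s₂ (here (cong ¬' (subsF-▻ (liftSubs k σs) _ φ))))

corollary5p8 : {R : Set} (ar : R → ℕ) (D C : Set) → Infinite C →
               (S : List (Sentence ar D C) → Set₁) →
               IsConsistencyProperty ar D C S →
               ∀ s → S s → ¬ SeqDerivable ar D C s
-- The forcing model takes its individuals from the constants themselves.
corollary5p8 ar D C _ S cp s s∈S s⊢ =
  sound s⊢ ∅ᵉ s s∈S (λ { _ (φ , φ∈s , refl) → ∈⇒⊩ φ ε s∈S φ∈s }) (λ _ ())
  where open Forcing ar D C S cp
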